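{- For every positive integer $n$, $$W_{n+1}^{2}-q^{2}W_{n-1}^{2}=p\left(W_{1}W_{2n}+qW_{0}W_{2n-1}\right).$$
   Context: Let $H$ be the real quaternion algebra with basis $1,i,j,k$ and (non-commutative) multiplication determined by $i^2=j^2=k^2=-1$, $ij=-ji=k$, $jk=-kj=i$, $ki=-ik=j$; real scalars commute with all quaternions. Fix real numbers $p,q$. The Horadam sequence $w_n=w_n(w_0,w_1;p,q)$ has real initial values $w_0,w_1$ and satisfies $w_n=pw_{n-1}+qw_{n-2}$ for $n\ge 2$. The Horadam quaternions are $W_n=w_n+w_{n+1}i+w_{n+2}j+w_{n+3}k$, and $W_n^2=W_nW_n$. -}

module Defs where

open import Level using (_⊔_)
open import Data.Nat using (ℕ; zero; suc)
open import Data.Product using (_×_)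
open import Algebra.Bundles using (CommutativeRing)

-- Quaternion algebra over a commutative ring R (for R = ℝ this is the real
-- quaternion algebra H with basis 1, i, j, k), and Horadam sequences over R.
module Quaternion {c ℓ} (R : CommutativeRing c ℓ) where
  open CommutativeRing R

  record ℍ : Set c where
    constructor quat
    field
      re : Carrier
      im-i : Carrier
      im-j : Carrier
      im-k : Carrier
  open ℍ public

  _≋_ : ℍ → ℍ → Set ℓ
  x ≋ y = (re x ≈ re y) × ((im-i x ≈ im-i y) × ((im-j x ≈ im-j y) × (im-k x ≈ im-k y)))

  infixl 6 _⊕_ _⊖_
  infixl 7 _⊗_ _◃_
  infix 4 _≋_

  _⊕_ : ℍ → ℍ → ℍ
  quat a0 a1 a2 a3 ⊕ quat b0 b1 b2 b3 = quat (a0 + b0) (a1 + b1) (a2 + b2) (a3 + b3)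

  _⊖_ : ℍ → ℍ → ℍ
  quat a0 a1 a2 a3 ⊖ quat b0 b1 b2 b3 = quat (a0 - b0) (a1 - b1) (a2 - b2) (a3 - b3)

  _◃_ : Carrier → ℍ → ℍ
  s ◃ quat a0 a1 a2 a3 = quat (s * a0) (s * a1) (s * a2) (s * a3)

  -- Hamilton product: i² = j² = k² = -1, ij = -ji = k, jk = -kj = i, ki = -ik = j
  _⊗_ : ℍ → ℍ → ℍ
  quat a0 a1 a2 a3 ⊗ quat b0 b1 b2 b3 =
    quat (a0 * b0 - a1 * b1 - a2 * b2 - a3 * b3)
         (a0 * b1 + a1 * b0 + a2 * b3 - a3 * b2)
         (a0 * b2 - a1 * b3 + a2 * b0 + a3 * b1)
         (a0 * b3 + a1 * b2 - a2 * b1 + a3 * b0)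

  _² : ℍ → ℍ
  x ² = x ⊗ x

  horadam : (w0 w1 p q : Carrier) → ℕ → Carrier
  horadam w0 w1 p q zero = w0
  horadam w0 w1 p q (suc zero) = w1
  horadam w0 w1 p q (suc (suc n)) = p * horadam w0 w1 p q (suc n) + q * horadam w0 w1 p q n

  horadamQ : (w0 w1 p q : Carrier) → ℕ → ℍ
  horadamQ w0 w1 p q n =
    quat (horadam w0 w1 p q n) (horadam w0 w1 p q (suc n))
         (horadam w0 w1 p q (suc (suc n))) (horadam w0 w1 p q (suc (suc (suc n))))

-- Write W for the Horadam quaternions, so W(n+2) = p W(n+1) + q W(n), and put
--   T j l = W(j+1) W(l+1) + q W(j) W(l).
-- The proof uses only that the Hamilton product is bilinear (it is not
-- commutative, so the order of every product is kept).
--  * Shifting: T (j+1) l = T j (l+1); expanding W(j+2) resp. W(l+2) by the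
--    recurrence, both sides become p W(j+1)W(l+1) + q W(j)W(l+1) + q W(j+1)W(l).
--    Iterating, T j l = T 0 (j+l).
--  * Squaring: W(m+2)² − q² W(m)² = p T (m+1) m, again by expanding W(m+2).
-- Hence W(m+2)² − q² W(m)² = p T m (m+1) = p T 0 (2m+1), the theorem for n = m+1.
module Submission where

open import Defs
open import Data.Nat using (ℕ; _≤_; _∸_; zero; suc; s≤s; z≤n) renaming (_+_ to _+ℕ_; _*_ to _*ℕ_)
import Data.Nat.Properties as ℕₚ
import Data.Integer as ℤ
import Data.Integer.Properties as ℤₚ
import Data.Sign as Sign
open import Data.Fin using (#_)
open import Data.Vec using (Vec; []; _∷_; _++_)
open import Data.Maybe using (Maybe; just; nothing)
open import Data.Product using (_,_)
open import Relation.Binary.Bundles using (Setoid)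
import Relation.Binary.PropositionalEquality as ≡
open import Relation.Nullary using (yes; no)
open import Algebra.Bundles using (CommutativeRing)
import Algebra.Solver.Ring
open import Algebra.Solver.Ring.AlmostCommutativeRing using (fromCommutativeRing; _-Raw-AlmostCommutative⟶_)

-- It lets the standard ring
-- solver normalise polynomials over an arbitrary commutative ring R with
-- integer coefficients, which compute, so that equal normal forms are
-- recognised definitionally.
module IntegerCoefficients {c ℓ} (R : CommutativeRing c ℓ) where
  open CommutativeRing R
  open ℤ using (ℤ; +_; -[1+_]; _⊖_)
  open import Relation.Binary.Reasoning.Setoid setoid
  open import Algebra.Definitions.RawMonoid +-rawMonoid using (_×_)
  open import Algebra.Properties.Monoid.Mult +-monoid using (×-homo-+)
  open import Algebra.Properties.Semiring.Mult semiring using (×1-homo-*)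
  open import Algebra.Properties.Ring ring using (-‿distribˡ-*; -‿distribʳ-*)
  open import Algebra.Properties.AbelianGroup +-abelianGroup using (⁻¹-∙-comm)
  open import Algebra.Properties.Group +-group using (⁻¹-involutive; ε⁻¹≈ε)
  open import Algebra.Properties.CommutativeSemigroup +-commutativeSemigroup using (interchange)

  fromℕ : ℕ → Carrier
  fromℕ n = n × 1#

  fromℤ : ℤ → Carrier
  fromℤ (+ n) = fromℕ n
  fromℤ -[1+ n ] = - fromℕ (suc n)

  -- integer addition is defined through the truncated difference _⊖_
  fromℤ-⊖ : ∀ m n → fromℤ (m ⊖ n) ≈ fromℕ m - fromℕ n
  fromℤ-⊖ zero zero = sym (trans (+-congˡ ε⁻¹≈ε) (+-identityˡ 0#))
  fromℤ-⊖ (suc m) zero = sym (trans (+-congˡ ε⁻¹≈ε) (+-identityʳ _))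
  fromℤ-⊖ zero (suc n) = sym (+-identityˡ _)
  fromℤ-⊖ (suc m) (suc n) = begin
    fromℤ (suc m ⊖ suc n)                ≡⟨ ≡.cong fromℤ (ℤₚ.[1+m]⊖[1+n]≡m⊖n m n) ⟩
    fromℤ (m ⊖ n)                        ≈⟨ fromℤ-⊖ m n ⟩
    fromℕ m - fromℕ n                    ≈⟨ +-identityˡ _ ⟨
    0# + (fromℕ m - fromℕ n)             ≈⟨ +-congʳ (-‿inverseʳ 1#) ⟨
    (1# - 1#) + (fromℕ m - fromℕ n)      ≈⟨ interchange 1# (- 1#) (fromℕ m) (- fromℕ n) ⟩
    fromℕ (suc m) + (- 1# - fromℕ n)     ≈⟨ +-congˡ (⁻¹-∙-comm 1# (fromℕ n)) ⟩
    fromℕ (suc m) - fromℕ (suc n)        ∎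

  -- integer multiplication is defined through signs and absolute values
  fromℤ-+◃ : ∀ k → fromℤ (Sign.+ ℤ.◃ k) ≈ fromℕ k
  fromℤ-+◃ zero = refl
  fromℤ-+◃ (suc k) = refl

  fromℤ--◃ : ∀ k → fromℤ (Sign.- ℤ.◃ k) ≈ - fromℕ k
  fromℤ--◃ zero = sym ε⁻¹≈ε
  fromℤ--◃ (suc k) = refl

  fromℤ-+ : ∀ i j → fromℤ (i ℤ.+ j) ≈ fromℤ i + fromℤ j
  fromℤ-+ (+ m) (+ n) = ×-homo-+ 1# m n
  fromℤ-+ (+ m) -[1+ n ] = fromℤ-⊖ m (suc n)
  fromℤ-+ -[1+ m ] (+ n) = trans (fromℤ-⊖ n (suc m)) (+-comm _ _)
  fromℤ-+ -[1+ m ] -[1+ n ] = begin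
    - fromℕ (suc (suc (m +ℕ n)))          ≡⟨ ≡.cong (λ k → - fromℕ (suc k)) (ℕₚ.+-suc m n) ⟨
    - fromℕ (suc m +ℕ suc n)              ≈⟨ -‿cong (×-homo-+ 1# (suc m) (suc n)) ⟩
    - (fromℕ (suc m) + fromℕ (suc n))     ≈⟨ ⁻¹-∙-comm _ _ ⟨
    - fromℕ (suc m) - fromℕ (suc n)       ∎

  fromℤ-* : ∀ i j → fromℤ (i ℤ.* j) ≈ fromℤ i * fromℤ j
  fromℤ-* (+ m) (+ n) = trans (fromℤ-+◃ (m *ℕ n)) (×1-homo-* m n)
  fromℤ-* (+ m) -[1+ n ] =
    trans (fromℤ--◃ (m *ℕ suc n)) (trans (-‿cong (×1-homo-* m (suc n))) (-‿distribʳ-* _ _))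
  fromℤ-* -[1+ m ] (+ n) =
    trans (fromℤ--◃ (suc m *ℕ n)) (trans (-‿cong (×1-homo-* (suc m) n)) (-‿distribˡ-* _ _))
  fromℤ-* -[1+ m ] -[1+ n ] = begin
    fromℕ (suc m *ℕ suc n)                ≈⟨ ×1-homo-* (suc m) (suc n) ⟩
    fromℕ (suc m) * fromℕ (suc n)         ≈⟨ ⁻¹-involutive _ ⟨
    - - (fromℕ (suc m) * fromℕ (suc n))   ≈⟨ -‿cong (-‿distribˡ-* _ _) ⟩
    - (- fromℕ (suc m) * fromℕ (suc n))   ≈⟨ -‿distribʳ-* _ _ ⟩
    - fromℕ (suc m) * - fromℕ (suc n)     ∎

  fromℤ-- : ∀ i → fromℤ (ℤ.- i) ≈ - fromℤ i
  fromℤ-- (+ zero) = sym ε⁻¹≈ε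
  fromℤ-- (+ suc n) = refl
  fromℤ-- -[1+ n ] = sym (⁻¹-involutive _)

  fromℤ-homomorphism : ℤ.+-*-rawRing -Raw-AlmostCommutative⟶ fromCommutativeRing R
  fromℤ-homomorphism = record
    { ⟦_⟧ = fromℤ ; +-homo = fromℤ-+ ; *-homo = fromℤ-* ; -‿homo = fromℤ--
    ; 0-homo = refl ; 1-homo = +-identityʳ 1# }

  -- the solver only needs to recognise equal coefficients
  fromℤ-≟ : ∀ i j → Maybe (fromℤ i ≈ fromℤ j)
  fromℤ-≟ i j with i ℤ.≟ j
  ... | yes ≡.refl = just refl
  ... | no _ = nothing

  open Algebra.Solver.Ring ℤ.+-*-rawRing (fromCommutativeRing R) fromℤ-homomorphism fromℤ-≟ public
    using (Polynomial; var; _:+_; _:*_; _:-_; ⟦_⟧; ⟦_⟧↓; prove)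

module QuaternionAlgebra {c ℓ} (R : CommutativeRing c ℓ) where
  open CommutativeRing R
  open Quaternion R
  open import Algebra.Properties.CommutativeSemigroup +-commutativeSemigroup using (xy∙z≈xz∙y)

  ≋-refl : ∀ {x} → x ≋ x
  ≋-refl = refl , refl , refl , refl

  ≋-sym : ∀ {x y} → x ≋ y → y ≋ x
  ≋-sym (e₀ , e₁ , e₂ , e₃) = sym e₀ , sym e₁ , sym e₂ , sym e₃

  ≋-trans : ∀ {x y z} → x ≋ y → y ≋ z → x ≋ z
  ≋-trans (e₀ , e₁ , e₂ , e₃) (f₀ , f₁ , f₂ , f₃) = trans e₀ f₀ , trans e₁ f₁ , trans e₂ f₂ , trans e₃ f₃

  ≋-setoid : Setoid c ℓ
  ≋-setoid = record
    { Carrier = ℍ ; _≈_ = _≋_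
    ; isEquivalence = record { refl = ≋-refl ; sym = ≋-sym ; trans = ≋-trans } }

  ⊕-cong : ∀ {x y u v} → x ≋ y → u ≋ v → x ⊕ u ≋ y ⊕ v
  ⊕-cong (e₀ , e₁ , e₂ , e₃) (f₀ , f₁ , f₂ , f₃) = +-cong e₀ f₀ , +-cong e₁ f₁ , +-cong e₂ f₂ , +-cong e₃ f₃

  ⊖-congʳ : ∀ {x y} u → x ≋ y → x ⊖ u ≋ y ⊖ u
  ⊖-congʳ u (e₀ , e₁ , e₂ , e₃) = +-congʳ e₀ , +-congʳ e₁ , +-congʳ e₂ , +-congʳ e₃

  ◃-cong : ∀ s {x y} → x ≋ y → s ◃ x ≋ s ◃ y
  ◃-cong s (e₀ , e₁ , e₂ , e₃) = *-congˡ e₀ , *-congˡ e₁ , *-congˡ e₂ , *-congˡ e₃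

  open import Relation.Binary.Reasoning.Setoid ≋-setoid

  -- The operations repeat those of
  -- Defs on expressions, so evaluating an expression quaternion built from
  -- them is definitionally the corresponding quaternion operation.  This lets
  -- the ring solver check a quaternion identity component by component.

  open IntegerCoefficients R using (Polynomial; var; _:+_; _:*_; _:-_; ⟦_⟧; ⟦_⟧↓; prove)

  record ℍₑ (n : ℕ) : Set c where
    constructor quatₑ
    field reₑ iₑ jₑ kₑ : Polynomial n

  infixl 6 _⊕ₑ_ _⊖ₑ_
  infixl 7 _⊗ₑ_ _◃ₑ_

  _⊕ₑ_ _⊖ₑ_ _⊗ₑ_ : ∀ {n} → ℍₑ n → ℍₑ n → ℍₑ n
  quatₑ a₀ a₁ a₂ a₃ ⊕ₑ quatₑ b₀ b₁ b₂ b₃ = quatₑ (a₀ :+ b₀) (a₁ :+ b₁) (a₂ :+ b₂) (a₃ :+ b₃)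
  quatₑ a₀ a₁ a₂ a₃ ⊖ₑ quatₑ b₀ b₁ b₂ b₃ = quatₑ (a₀ :- b₀) (a₁ :- b₁) (a₂ :- b₂) (a₃ :- b₃)
  quatₑ a₀ a₁ a₂ a₃ ⊗ₑ quatₑ b₀ b₁ b₂ b₃ =
    quatₑ (a₀ :* b₀ :- a₁ :* b₁ :- a₂ :* b₂ :- a₃ :* b₃)
          (a₀ :* b₁ :+ a₁ :* b₀ :+ a₂ :* b₃ :- a₃ :* b₂)
          (a₀ :* b₂ :- a₁ :* b₃ :+ a₂ :* b₀ :+ a₃ :* b₁)
          (a₀ :* b₃ :+ a₁ :* b₂ :- a₂ :* b₁ :+ a₃ :* b₀)

  _◃ₑ_ : ∀ {n} → Polynomial n → ℍₑ n → ℍₑ n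
  s ◃ₑ quatₑ a₀ a₁ a₂ a₃ = quatₑ (s :* a₀) (s :* a₁) (s :* a₂) (s :* a₃)

  ⟦_⟧ₕ ⟦_⇓⟧ₕ : ∀ {n} → ℍₑ n → Vec Carrier n → ℍ
  ⟦ quatₑ a₀ a₁ a₂ a₃ ⟧ₕ ρ = quat (⟦ a₀ ⟧ ρ) (⟦ a₁ ⟧ ρ) (⟦ a₂ ⟧ ρ) (⟦ a₃ ⟧ ρ)
  ⟦ quatₑ a₀ a₁ a₂ a₃ ⇓⟧ₕ ρ = quat (⟦ a₀ ⟧↓ ρ) (⟦ a₁ ⟧↓ ρ) (⟦ a₂ ⟧↓ ρ) (⟦ a₃ ⟧↓ ρ)

  ℍ-solve : ∀ {n} (ρ : Vec Carrier n) (a b : ℍₑ n) → ⟦ a ⇓⟧ₕ ρ ≋ ⟦ b ⇓⟧ₕ ρ → ⟦ a ⟧ₕ ρ ≋ ⟦ b ⟧ₕ ρ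
  ℍ-solve ρ (quatₑ a₀ a₁ a₂ a₃) (quatₑ b₀ b₁ b₂ b₃) (e₀ , e₁ , e₂ , e₃) =
    prove ρ a₀ b₀ e₀ , prove ρ a₁ b₁ e₁ , prove ρ a₂ b₂ e₂ , prove ρ a₃ b₃ e₃

  private
    σ τ : Polynomial 14
    σ = var (# 0)
    τ = var (# 1)

    X Y Z : ℍₑ 14
    X = quatₑ (var (# 2)) (var (# 3)) (var (# 4)) (var (# 5))
    Y = quatₑ (var (# 6)) (var (# 7)) (var (# 8)) (var (# 9))
    Z = quatₑ (var (# 10)) (var (# 11)) (var (# 12)) (var (# 13))

    components : ℍ → Vec Carrier 4
    components x = re x ∷ im-i x ∷ im-j x ∷ im-k x ∷ []

    at : Carrier → Carrier → ℍ → ℍ → ℍ → Vec Carrier 14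
    at s t x y z = s ∷ t ∷ components x ++ components y ++ components z

  ⊗-linearˡ : ∀ s t x y z → (s ◃ x ⊕ t ◃ y) ⊗ z ≋ s ◃ (x ⊗ z) ⊕ t ◃ (y ⊗ z)
  ⊗-linearˡ s t x y z =
    ℍ-solve (at s t x y z) ((σ ◃ₑ X ⊕ₑ τ ◃ₑ Y) ⊗ₑ Z) (σ ◃ₑ (X ⊗ₑ Z) ⊕ₑ τ ◃ₑ (Y ⊗ₑ Z)) ≋-refl

  ⊗-linearʳ : ∀ s t x y z → x ⊗ (s ◃ y ⊕ t ◃ z) ≋ s ◃ (x ⊗ y) ⊕ t ◃ (x ⊗ z)
  ⊗-linearʳ s t x y z =
    ℍ-solve (at s t x y z) (X ⊗ₑ (σ ◃ₑ Y ⊕ₑ τ ◃ₑ Z)) (σ ◃ₑ (X ⊗ₑ Y) ⊕ₑ τ ◃ₑ (X ⊗ₑ Z)) ≋-refl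

  ⊕-swapʳ : ∀ x y z → x ⊕ y ⊕ z ≋ x ⊕ z ⊕ y
  ⊕-swapʳ x y z = xy∙z≈xz∙y _ _ _ , xy∙z≈xz∙y _ _ _ , xy∙z≈xz∙y _ _ _ , xy∙z≈xz∙y _ _ _

  cancel-q² : ∀ p q x y z → p ◃ x ⊕ q ◃ (p ◃ y ⊕ q ◃ z) ⊖ (q * q) ◃ z ≋ p ◃ (x ⊕ q ◃ y)
  cancel-q² p q x y z =
    ℍ-solve (at p q x y z) (σ ◃ₑ X ⊕ₑ τ ◃ₑ (σ ◃ₑ Y ⊕ₑ τ ◃ₑ Z) ⊖ₑ (τ :* τ) ◃ₑ Z) (σ ◃ₑ (X ⊕ₑ τ ◃ₑ Y)) ≋-refl

  -- Consequences of a second-order linear recurrence, stated for arbitrary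
  -- quaternions: think of a, b as consecutive terms and p ◃ b ⊕ q ◃ a as the next one.

  -- Moving the recurrence step from the left factor to the right factor.
  shift-identity : ∀ p q a b c d →
    (p ◃ b ⊕ q ◃ a) ⊗ d ⊕ q ◃ (b ⊗ c) ≋ b ⊗ (p ◃ d ⊕ q ◃ c) ⊕ q ◃ (a ⊗ d)
  shift-identity p q a b c d = begin
    (p ◃ b ⊕ q ◃ a) ⊗ d ⊕ q ◃ (b ⊗ c)                ≈⟨ ⊕-cong (⊗-linearˡ p q b a d) ≋-refl ⟩
    p ◃ (b ⊗ d) ⊕ q ◃ (a ⊗ d) ⊕ q ◃ (b ⊗ c)          ≈⟨ ⊕-swapʳ _ _ _ ⟩
    p ◃ (b ⊗ d) ⊕ q ◃ (b ⊗ c) ⊕ q ◃ (a ⊗ d)          ≈⟨ ⊕-cong (⊗-linearʳ p q b d c) ≋-refl ⟨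
    b ⊗ (p ◃ d ⊕ q ◃ c) ⊕ q ◃ (a ⊗ d)                ∎

  -- Difference of squares of the terms two steps apart.
  square-identity : ∀ p q a b → let x = p ◃ a ⊕ q ◃ b in
    x ² ⊖ (q * q) ◃ b ² ≋ p ◃ (x ⊗ a ⊕ q ◃ (a ⊗ b))
  square-identity p q a b = begin
    x ⊗ x ⊖ (q * q) ◃ (b ⊗ b)
      ≈⟨ ⊖-congʳ _ (⊗-linearʳ p q x a b) ⟩
    p ◃ (x ⊗ a) ⊕ q ◃ (x ⊗ b) ⊖ (q * q) ◃ (b ⊗ b)
      ≈⟨ ⊖-congʳ _ (⊕-cong ≋-refl (◃-cong q (⊗-linearˡ p q a b b))) ⟩
    p ◃ (x ⊗ a) ⊕ q ◃ (p ◃ (a ⊗ b) ⊕ q ◃ (b ⊗ b)) ⊖ (q * q) ◃ (b ⊗ b)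
      ≈⟨ cancel-q² p q _ _ _ ⟩
    p ◃ (x ⊗ a ⊕ q ◃ (a ⊗ b))
      ∎
    where
    x : ℍ
    x = p ◃ a ⊕ q ◃ b

module HoradamQuaternions {c ℓ} (R : CommutativeRing c ℓ) (p q w0 w1 : CommutativeRing.Carrier R) where
  open CommutativeRing R using (_*_)
  open Quaternion R
  open QuaternionAlgebra R
  open import Relation.Binary.Reasoning.Setoid ≋-setoid

  -- W satisfies the recurrence definitionally: W(n+2) is p ◃ W(n+1) ⊕ q ◃ W(n),
  -- so the identities for arbitrary quaternions apply to W without rewriting.
  W : ℕ → ℍ
  W = horadamQ w0 w1 p q

  T : ℕ → ℕ → ℍ
  T j l = W (suc j) ⊗ W (suc l) ⊕ q ◃ (W j ⊗ W l)

  T-shift : ∀ j l → T (suc j) l ≋ T j (suc l)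
  T-shift j l = shift-identity p q (W j) (W (suc j)) (W l) (W (suc l))

  T-telescope : ∀ j l → T 0 (j +ℕ l) ≋ T j l
  T-telescope zero l = ≋-refl
  T-telescope (suc j) l = begin
    T 0 (suc j +ℕ l)  ≡⟨ ≡.cong (T 0) (ℕₚ.+-suc j l) ⟨
    T 0 (j +ℕ suc l)  ≈⟨ T-telescope j (suc l) ⟩
    T j (suc l)       ≈⟨ T-shift j l ⟨
    T (suc j) l       ∎

  -- The theorem for n = m + 1, with the indices in the form the recursion produces.
  W-square-difference : ∀ m → W (suc (suc m)) ² ⊖ (q * q) ◃ W m ² ≋ p ◃ T 0 (m +ℕ suc m)
  W-square-difference m = begin
    W (suc (suc m)) ² ⊖ (q * q) ◃ W m ²  ≈⟨ square-identity p q (W (suc m)) (W m) ⟩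
    p ◃ T (suc m) m                      ≈⟨ ◃-cong p (T-shift m m) ⟩
    p ◃ T m (suc m)                      ≈⟨ ◃-cong p (T-telescope m (suc m)) ⟨
    p ◃ T 0 (m +ℕ suc m)                 ∎

corollary2p2 : ∀ {c ℓ} (R : CommutativeRing c ℓ) → let open Quaternion R in
    ∀ (p q w0 w1 : CommutativeRing.Carrier R) (n : ℕ) → 1 ≤ n →
    let W = horadamQ w0 w1 p q in
    (W (n +ℕ 1)) ² ⊖ (CommutativeRing._*_ R q q) ◃ (W (n ∸ 1)) ²
    ≋ p ◃ (W 1 ⊗ W (2 *ℕ n) ⊕ q ◃ (W 0 ⊗ W (2 *ℕ n ∸ 1)))
corollary2p2 R p q w0 w1 (suc m) (s≤s z≤n)
  rewrite ℕₚ.+-comm m 1 | ℕₚ.+-identityʳ m =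
  HoradamQuaternions.W-square-difference R p q w0 w1 m
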